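{- During the execution of the A* variant described in the context (at the beginning of every iteration), if vertices $v$ and $v'$ are both discovered, with $v'$ a successor of $v$, and $g[v]+w(v,v')<g[v']$, then $v$ is on OPEN.
   Context: A* variant with reopening on a directed graph $G=(V,E)$ with edge weights $w:E\to[0,+\infty]$, start $v_{\mathrm{start}}$, and a heuristic $h$ (possibly changing between iterations): maintain $g[\cdot]$ ($g[v_{\mathrm{start}}]=0$, otherwise $\infty$), OPEN (initially $\{v_{\mathrm{start}}\}$) and CLOSED (initially empty). Each iteration removes from OPEN a vertex $v$ of minimal $f(v)=g[v]+h(v)$, places it on CLOSED, and for each successor $v'$: if $g[v]+w(v,v')<g[v']$, sets $g[v']\leftarrow g[v]+w(v,v')$ and moves $v'$ to OPEN (removing it from CLOSED if present). A vertex is "discovered" if it is on OPEN or CLOSED. -}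

module Defs where

open import Level using (0ℓ)
open import Data.Product using (Σ; _×_; _,_)
open import Data.Sum using (_⊎_)
open import Relation.Nullary using (¬_)
open import Relation.Binary.PropositionalEquality using (_≡_; _≢_)
open import Relation.Binary.Structures using (IsStrictTotalOrder)
open import Algebra.Structures using (IsCommutativeMonoid)

-- Agda has no real numbers, so we abstract
-- the properties of the extended non-negative reals that the algorithm
-- uses: a strict total order, a commutative monoid (_+_, 0#), an
-- absorbing top element ∞, 0# least, and monotone addition.
-- ([0,+∞] with its usual order and addition is an instance.)

record WeightDomain : Set₁ where
  infixl 6 _+_
  infix  4 _<_
  field
    W       : Set
    _<_     : W → W → Set
    _+_     : W → W → W
    0#      : W
    ∞       : W
    <-isStrictTotalOrder : IsStrictTotalOrder _≡_ _<_
    +-isCommutativeMonoid : IsCommutativeMonoid _≡_ _+_ 0#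
    +-∞     : ∀ x → x + ∞ ≡ ∞
    ∞-top   : ∀ x → ¬ (∞ < x)
    0-least : ∀ x → ¬ (x < 0#)
    +-mono  : ∀ x y z → x < y → (z + x < z + y) ⊎ (z + x ≡ z + y)

data Status : Set where
  undiscovered OPEN CLOSED : Status

module AStar (D : WeightDomain) where
  open WeightDomain D

  record State (V : Set) : Set where
    constructor ⟨_,_⟩
    field
      g  : V → W
      st : V → Status
  open State public

  Discovered : {V : Set} → State V → V → Set
  Discovered s v = st s v ≢ undiscovered

  module Run {V : Set} (E : V → V → Set) (w : V → V → W) (vstart : V) where

    Initial : State V → Set
    Initial s =
      (g s vstart ≡ 0#) × (∀ u → u ≢ vstart → g s u ≡ ∞) ×
      (st s vstart ≡ OPEN) × (∀ u → u ≢ vstart → st s u ≡ undiscovered)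

    Improves : State V → V → V → Set
    Improves s v v' = E v v' × (g s v + w v v' < g s v')

    record Expand (h : V → W) (v : V) (s s' : State V) : Set where
      field
        onOpen    : st s v ≡ OPEN
        minimal   : ∀ u → st s u ≡ OPEN → ¬ (g s u + h u < g s v + h v)
        improved  : ∀ u → Improves s v u →
                      (g s' u ≡ g s v + w v u) × (st s' u ≡ OPEN)
        expanded  : ¬ Improves s v v → g s' v ≡ g s v × st s' v ≡ CLOSED
        untouched : ∀ u → ¬ Improves s v u → u ≢ v →
                      (g s' u ≡ g s u) × (st s' u ≡ st s u)

    -- An iteration: some heuristic (which may change from iteration to
    -- iteration, arbitrarily) and some vertex selected for expansion.
    Step : State V → State V → Set
    Step s s' = Σ (V → W) λ h → Σ V λ v → Expand h v s s'

    data Reachable : State V → Set where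
      init : ∀ {s} → Initial s → Reachable s
      step : ∀ {s s'} → Reachable s → Step s s' → Reachable s'

-- Invariant: no edge leaving a CLOSED vertex can improve its target.
-- Expanding x closes x only after relaxing all of its edges, while every
-- other CLOSED vertex keeps its g-value and g-values elsewhere only
-- decrease, so the invariant survives each iteration.  A discovered vertex
-- with an improvable outgoing edge is therefore not CLOSED, i.e. on OPEN.
module Submission where

open import Defs
open import Data.Empty using (⊥-elim)
open import Data.Product using (_,_; proj₁; proj₂)
open import Relation.Binary.PropositionalEquality using (_≡_; _≢_; refl; sym; trans; subst)
open import Relation.Binary.Structures using (IsStrictTotalOrder)
open import Relation.Nullary using (¬_; yes; no)
open import Relation.Nullary.Decidable using (decidable-stable; ¬¬-excluded-middle)

OPEN≢CLOSED : OPEN ≢ CLOSED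
OPEN≢CLOSED ()

undiscovered≢CLOSED : undiscovered ≢ CLOSED
undiscovered≢CLOSED ()

module _ (D : WeightDomain) where
  open WeightDomain D
  open AStar D
  open IsStrictTotalOrder <-isStrictTotalOrder using (_≟_; _<?_; irrefl)
    renaming (trans to <-trans)

  module _ {V : Set} (E : V → V → Set) (w : V → V → W) (vstart : V) where
    open Run E w vstart

    -- Equality on V is not decidable, so case splits on vertices are made
    -- under a double negation, escaped because the goal is ⊥ or decidable.

    initial-closed-empty : ∀ {s} → Initial s → ∀ u → st s u ≢ CLOSED
    initial-closed-empty (_ , _ , start-open , others-undiscovered) u u-closed =
      ¬¬-excluded-middle {A = u ≡ vstart} λ where
        (yes refl) → OPEN≢CLOSED (trans (sym start-open) u-closed)
        (no u≢start) →
          undiscovered≢CLOSED (trans (sym (others-undiscovered u u≢start)) u-closed)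

    module ExpandProperties {h x s s'} (ex : Expand h x s s') where
      open Expand ex

      g-unimproved : ∀ u → ¬ Improves s x u → g s' u ≡ g s u
      g-unimproved u ¬improves = decidable-stable (g s' u ≟ g s u) λ g-changed →
        ¬¬-excluded-middle {A = u ≡ x} λ where
          (yes refl) → g-changed (proj₁ (expanded ¬improves))
          (no u≢x) → g-changed (proj₁ (untouched u ¬improves u≢x))

      g-antitone : ∀ {a} u → a < g s' u → a < g s u
      g-antitone {a} u a<g' = decidable-stable (a <? g s u) λ a≮g →
        ¬¬-excluded-middle {A = Improves s x u} λ where
          (yes improves) →
            a≮g (<-trans (subst (a <_) (proj₁ (improved u improves)) a<g') (proj₂ improves))
          (no ¬improves) → a≮g (subst (a <_) (g-unimproved u ¬improves) a<g')

      closed-unimproved : ∀ u → st s' u ≡ CLOSED → ¬ Improves s x u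
      closed-unimproved u u-closed improves =
        OPEN≢CLOSED (trans (sym (proj₂ (improved u improves))) u-closed)

      closed-other-was-closed : ∀ u → st s' u ≡ CLOSED → u ≢ x → st s u ≡ CLOSED
      closed-other-was-closed u u-closed u≢x =
        trans (sym (proj₂ (untouched u (closed-unimproved u u-closed) u≢x))) u-closed

    ClosedConsistent : State V → Set
    ClosedConsistent s = ∀ v v' → st s v ≡ CLOSED → ¬ Improves s v v'

    initial-closedConsistent : ∀ {s} → Initial s → ClosedConsistent s
    initial-closedConsistent initial v _ v-closed _ = initial-closed-empty initial v v-closed

    expand-closedConsistent : ∀ {h x s s'} → Expand h x s s' →
                              ClosedConsistent s → ClosedConsistent s'
    expand-closedConsistent {x = x} {s} {s'} ex consistent v v' v-closed (e , improvable') =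
      ¬¬-excluded-middle {A = v ≡ x} λ where
        -- x has just relaxed the edge to v', so g s' v' cannot exceed g s x + w x v'.
        (yes refl) →
          irrefl refl (subst (g s v + w v v' <_) (proj₁ (improved v' (e , improvable))) old-g-improves)
        (no v≢x) → consistent v v' (closed-other-was-closed v v-closed v≢x) (e , improvable)
      where
      open ExpandProperties ex
      open Expand ex using (improved)

      old-g-improves : g s v + w v v' < g s' v'
      old-g-improves = subst (λ a → a + w v v' < g s' v')
                             (g-unimproved v (closed-unimproved v v-closed)) improvable'

      improvable : g s v + w v v' < g s v'
      improvable = g-antitone v' old-g-improves

    reachable-closedConsistent : ∀ {s} → Reachable s → ClosedConsistent s
    reachable-closedConsistent (init i) = initial-closedConsistent i
    reachable-closedConsistent (step r (_ , _ , ex)) =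
      expand-closedConsistent ex (reachable-closedConsistent r)

mainTheorem8 : (D : WeightDomain) →
    let open WeightDomain D in
    let open AStar D in
    {V : Set} (E : V → V → Set) (w : V → V → W) (vstart : V) →
    let open Run E w vstart in
    (s : State V) → Reachable s →
    (v v' : V) → Discovered s v → Discovered s v' → E v v' →
    g s v + w v v' < g s v' →
    st s v ≡ OPEN
mainTheorem8 D E w vstart s r v v' v-discovered _ e improves = on-open (AStar.st s v) refl
  where
  on-open : ∀ σ → AStar.st s v ≡ σ → AStar.st s v ≡ OPEN
  on-open undiscovered v-undiscovered = ⊥-elim (v-discovered v-undiscovered)
  on-open OPEN v-open = v-open
  on-open CLOSED v-closed =
    ⊥-elim (reachable-closedConsistent D E w vstart r v v' v-closed (e , improves))
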